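{- For every connected bipartite graph $G$, every invariant factor of the distance matrix $D(G)$ that is greater than $1$ is even.
   Context: For a connected graph $G$, the distance matrix $D(G)$ has $uv$-entry $d_G(u,v)$, the graph distance. The invariant factors of an integer matrix are the nonzero diagonal entries $f_1\mid f_2\mid\cdots\mid f_r$ of its Smith normal form over $\mathbb Z$. -}

module Defs where

open import Data.Nat using (ℕ; zero; suc) renaming (_≤_ to _≤ℕ_; _<_ to _<ℕ_)
open import Data.Fin using (Fin; toℕ) renaming (zero to fzero; suc to fsuc)
open import Data.Integer using (ℤ; +_; _+_; _*_; _≤_)
open import Data.Integer.Divisibility using (_∣_)
open import Data.Bool using (Bool)
open import Data.Product using (Σ; _×_; ∃)
open import Relation.Binary.PropositionalEquality using (_≡_; _≢_)
open import Relation.Nullary using (¬_)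
open import Level using (0ℓ) renaming (suc to lsuc)

record Graph (n : ℕ) : Set₁ where
  field
    Adj   : Fin n → Fin n → Set
    sym   : ∀ {u v} → Adj u v → Adj v u
    irrefl : ∀ {u} → ¬ Adj u u
open Graph public

data Walk {n : ℕ} (G : Graph n) : Fin n → Fin n → ℕ → Set where
  nil  : ∀ u → Walk G u u 0
  cons : ∀ {u w v k} → Adj G u w → Walk G w v k → Walk G u v (suc k)

Connected : ∀ {n} → Graph n → Set
Connected {n} G = ∀ (u v : Fin n) → ∃ λ k → Walk G u v k

IsDistance : ∀ {n} → Graph n → Fin n → Fin n → ℕ → Set
IsDistance G u v d = Walk G u v d × (∀ k → Walk G u v k → d ≤ℕ k)

Bipartite : ∀ {n} → Graph n → Set
Bipartite {n} G = Σ (Fin n → Bool) λ c → ∀ {u v} → Adj G u v → c u ≢ c v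

Mat : ℕ → Set
Mat n = Fin n → Fin n → ℤ

sumFin : ∀ {n} → (Fin n → ℤ) → ℤ
sumFin {zero}  f = + 0
sumFin {suc n} f = f fzero + sumFin (λ i → f (fsuc i))

_⊗_ : ∀ {n} → Mat n → Mat n → Mat n
(A ⊗ B) i j = sumFin (λ k → A i k * B k j)

identity : ∀ {n} → Mat n
identity i j with Data.Fin._≟_ i j
... | Relation.Nullary.yes _ = + 1
... | Relation.Nullary.no _  = + 0

Unimodular : ∀ {n} → Mat n → Set
Unimodular {n} P = Σ (Mat n) λ Q →
  (∀ i j → (P ⊗ Q) i j ≡ identity i j) × (∀ i j → (Q ⊗ P) i j ≡ identity i j)

-- S is in Smith normal form: diagonal, nonnegative diagonal entries,
-- each diagonal entry divides all later ones (this forces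
-- f₁ ∣ f₂ ∣ … ∣ f_r followed by zeros, since 0 ∣ x only for x = 0).
IsSmithForm : ∀ {n} → Mat n → Set
IsSmithForm {n} S =
  (∀ i j → i ≢ j → S i j ≡ + 0) ×
  (∀ i → + 0 ≤ S i i) ×
  (∀ (i j : Fin n) → toℕ i <ℕ toℕ j → S i i ∣ S j j)

SmithNormalFormOf : ∀ {n} → Mat n → Mat n → Set
SmithNormalFormOf {n} A S =
  IsSmithForm S × Σ (Mat n) λ P → Σ (Mat n) λ Q →
    Unimodular P × Unimodular Q × (∀ i j → ((P ⊗ A) ⊗ Q) i j ≡ S i j)

IsInvariantFactor : ∀ {n} → Mat n → ℤ → Set
IsInvariantFactor {n} A f =
  Σ (Mat n) λ S → SmithNormalFormOf A S × Σ (Fin n) λ i → (S i i ≡ f) × (f ≢ + 0)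

IsDistanceMatrix : ∀ {n} → Graph n → Mat n → Set
IsDistanceMatrix {n} G D = ∀ (u v : Fin n) → Σ ℕ λ d → IsDistance G u v d × (D u v ≡ + d)

{-# OPTIONS --safe #-}

-- Colour the vertices by χ ∈ {0,1}. Every walk from u to v has the parity of χ u + χ v, so
-- D ≡ χ 1ᵀ + 1 χᵀ has rank at most 2 modulo 2, and hence so has the Smith form S = P D Q.
-- If an invariant factor f = S k k > 1 were odd, so would be every S i i with i ≤ k, since it
-- divides f. For k ≥ 2 the principal minor S₀₀ S₁₁ S₂₂ would be odd, contradicting the rank
-- bound. For k ≤ 1, f divides every later diagonal entry, so S ≡ diag(S₀₀, 0, …, 0) has rank
-- at most 1 modulo f, and so has D = P⁻¹ S Q⁻¹; but the principal 2 × 2 minor of D on an edge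
-- is -1, so f ∣ 1. A connected graph without edges has one vertex, and then D = 0 = S.

module Submission where

open import Defs hiding (sym)
open import Data.Nat using (ℕ)
open import Data.Integer using (ℤ; +_; _<_)
open import Data.Integer.Divisibility using (_∣_)

open import Data.Bool using (Bool; true; false)
open import Data.Empty using (⊥-elim)
open import Data.Fin using (Fin; toℕ; _≟_) renaming (zero to fzero; suc to fsuc)
open import Data.Fin.Properties using (toℕ-injective; suc-injective)
open import Data.Integer using (-_; _+_; _-_; _*_; ∣_∣; +<+)
open import Data.Integer.Divisibility.Signed using (divides; ∣m∣n⇒∣m+n; ∣m⇒∣-m; ∣m⇒∣m*n; ∣n⇒∣m*n; ∣ᵤ⇒∣; ∣⇒∣ᵤ)
  renaming (_∣_ to _∣ₛ_)
open import Data.Integer.Properties using (+-inverseʳ; +-identityˡ; +-identityʳ; *-identityˡ; *-identityʳ; *-zeroˡ; *-zeroʳ; *-assoc; *-distribˡ-+; *-distribʳ-+; abs-*)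
open import Data.Integer.Tactic.RingSolver using (solve-∀)
import Data.Nat as ℕ
open import Data.Nat using (z≤n; s≤s; s≤s⁻¹)
open import Data.Nat.Divisibility as ℕ∣ using () renaming (_∣_ to _∣ℕ_)
open import Data.Nat.Primality using (Prime; prime[2]; euclidsLemma)
open import Data.Nat.Properties using (m≤n⇒m<n∨m≡n; n≤0⇒n≡0; ≤-trans)
open import Data.Product using (Σ; ∃; ∃₂; _,_; proj₂)
open import Data.Sum using (_⊎_; inj₁; inj₂; [_,_]′; map₂)
open import Level using (0ℓ)
open import Relation.Binary.Bundles using (Setoid)
open import Relation.Binary.PropositionalEquality using (_≡_; _≢_; refl; sym; trans; cong; cong₂; subst; module ≡-Reasoning)
open import Relation.Nullary using (¬_; yes; no; contradiction)

private
  variable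
    a b c e n r : ℕ
    m x y z x′ y′ : ℤ

infix 4 _≡_mod_

-- A record rather than a synonym for m ∣ x - y, so that x and y can be inferred.
record _≡_mod_ (x y m : ℤ) : Set where
  constructor ≡-mod
  field divides-difference : m ∣ₛ x - y

≡⇒≡-mod : x ≡ y → x ≡ y mod m
≡⇒≡-mod {x} {m = m} refl = ≡-mod (divides (+ 0) (trans (+-inverseʳ x) (sym (*-zeroˡ m))))

≡-mod-sym : x ≡ y mod m → y ≡ x mod m
≡-mod-sym {x} {y} (≡-mod m∣x-y) = ≡-mod (subst (_ ∣ₛ_) (negate-difference x y) (∣m⇒∣-m m∣x-y))
  where
  negate-difference : ∀ x y → - (x - y) ≡ y - x
  negate-difference = solve-∀

≡-mod-trans : x ≡ y mod m → y ≡ z mod m → x ≡ z mod m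
≡-mod-trans {x} {y} {z = z} (≡-mod m∣x-y) (≡-mod m∣y-z) =
  ≡-mod (subst (_ ∣ₛ_) (telescope x y z) (∣m∣n⇒∣m+n m∣x-y m∣y-z))
  where
  telescope : ∀ x y z → (x - y) + (y - z) ≡ x - z
  telescope = solve-∀

≡-mod-setoid : ℤ → Setoid 0ℓ 0ℓ
≡-mod-setoid m = record
  { Carrier       = ℤ
  ; _≈_           = λ x y → x ≡ y mod m
  ; isEquivalence = record { refl = ≡⇒≡-mod refl ; sym = ≡-mod-sym ; trans = ≡-mod-trans }
  }

+-cong-mod : x ≡ x′ mod m → y ≡ y′ mod m → x + y ≡ x′ + y′ mod m
+-cong-mod {x} {x′} {y = y} {y′} (≡-mod p) (≡-mod q) =
  ≡-mod (subst (_ ∣ₛ_) (regroup x x′ y y′) (∣m∣n⇒∣m+n p q))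
  where
  regroup : ∀ x x′ y y′ → (x - x′) + (y - y′) ≡ (x + y) - (x′ + y′)
  regroup = solve-∀

-‿cong-mod : x ≡ x′ mod m → - x ≡ - x′ mod m
-‿cong-mod {x} {x′} (≡-mod p) = ≡-mod (subst (_ ∣ₛ_) (regroup x x′) (∣m⇒∣-m p))
  where
  regroup : ∀ x x′ → - (x - x′) ≡ (- x) - (- x′)
  regroup = solve-∀

*-cong-mod : x ≡ x′ mod m → y ≡ y′ mod m → x * y ≡ x′ * y′ mod m
*-cong-mod {x} {x′} {y = y} {y′} (≡-mod p) (≡-mod q) =
  ≡-mod (subst (_ ∣ₛ_) (regroup x x′ y y′) (∣m∣n⇒∣m+n (∣m⇒∣m*n y p) (∣n⇒∣m*n x′ q)))
  where
  regroup : ∀ x x′ y y′ → (x - x′) * y + x′ * (y - y′) ≡ x * y - x′ * y′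
  regroup = solve-∀

∣⇒≡0-mod : m ∣ x → x ≡ + 0 mod m
∣⇒≡0-mod {m} {x} m∣x = ≡-mod (subst (m ∣ₛ_) (sym (+-identityʳ x)) (∣ᵤ⇒∣ m∣x))

≡0-mod⇒∣ : x ≡ + 0 mod m → m ∣ x
≡0-mod⇒∣ {x} {m} (≡-mod m∣x-0) = ∣⇒∣ᵤ (subst (m ∣ₛ_) (+-identityʳ x) m∣x-0)

prime-∣-* : ∀ {p} → Prime p → ∀ x y → + p ∣ x * y → (+ p ∣ x) ⊎ (+ p ∣ y)
prime-∣-* p-prime x y p∣xy = euclidsLemma ∣ x ∣ ∣ y ∣ p-prime (subst (_ ∣ℕ_) (abs-* x y) p∣xy)

>1⇒∤1 : + 1 < x → ¬ (x ∣ + 1)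
>1⇒∤1 (+<+ (s≤s (s≤s _))) x∣1 = contradiction (ℕ∣.∣1⇒≡1 x∣1) λ ()

sumFin-cong : {f g : Fin n → ℤ} → (∀ i → f i ≡ g i) → sumFin f ≡ sumFin g
sumFin-cong {n = ℕ.zero}  f≡g = refl
sumFin-cong {n = ℕ.suc n} f≡g = cong₂ _+_ (f≡g fzero) (sumFin-cong (λ i → f≡g (fsuc i)))

sumFin-cong-mod : {f g : Fin n → ℤ} → (∀ i → f i ≡ g i mod m) → sumFin f ≡ sumFin g mod m
sumFin-cong-mod {n = ℕ.zero}  f≡g = ≡⇒≡-mod refl
sumFin-cong-mod {n = ℕ.suc n} f≡g = +-cong-mod (f≡g fzero) (sumFin-cong-mod (λ i → f≡g (fsuc i)))

sumFin-zero : ∀ n → sumFin {n} (λ _ → + 0) ≡ + 0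
sumFin-zero ℕ.zero    = refl
sumFin-zero (ℕ.suc n) = trans (+-identityˡ _) (sumFin-zero n)

sumFin-distrib-+ : (f g : Fin n → ℤ) → sumFin (λ i → f i + g i) ≡ sumFin f + sumFin g
sumFin-distrib-+ {ℕ.zero}  f g = refl
sumFin-distrib-+ {ℕ.suc n} f g = trans
  (cong (_+_ (f fzero + g fzero)) (sumFin-distrib-+ (λ i → f (fsuc i)) (λ i → g (fsuc i))))
  (interchange (f fzero) (g fzero) (sumFin (λ i → f (fsuc i))) (sumFin (λ i → g (fsuc i))))
  where
  interchange : ∀ w x y z → (w + x) + (y + z) ≡ (w + y) + (x + z)
  interchange = solve-∀

sumFin-*ˡ : (x : ℤ) (f : Fin n → ℤ) → sumFin (λ i → x * f i) ≡ x * sumFin f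
sumFin-*ˡ {ℕ.zero}  x f = sym (*-zeroʳ x)
sumFin-*ˡ {ℕ.suc n} x f = trans (cong (_+_ (x * f fzero)) (sumFin-*ˡ x (λ i → f (fsuc i))))
                                (sym (*-distribˡ-+ x (f fzero) _))

sumFin-*ʳ : (x : ℤ) (f : Fin n → ℤ) → sumFin (λ i → f i * x) ≡ sumFin f * x
sumFin-*ʳ {ℕ.zero}  x f = refl
sumFin-*ʳ {ℕ.suc n} x f = trans (cong (_+_ (f fzero * x)) (sumFin-*ʳ x (λ i → f (fsuc i))))
                                (sym (*-distribʳ-+ x (f fzero) _))

sumFin-swap : (f : Fin a → Fin b → ℤ) →
              sumFin (λ i → sumFin (λ j → f i j)) ≡ sumFin (λ j → sumFin (λ i → f i j))
sumFin-swap {ℕ.zero}  {b} f = sym (sumFin-zero b)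
sumFin-swap {ℕ.suc a} f = trans (cong (_+_ (sumFin (f fzero))) (sumFin-swap (λ i → f (fsuc i))))
                                (sym (sumFin-distrib-+ (f fzero) (λ j → sumFin (λ i → f (fsuc i) j))))

sumFin-single : (f : Fin n → ℤ) (i : Fin n) → (∀ j → j ≢ i → f j ≡ + 0) → sumFin f ≡ f i
sumFin-single {ℕ.suc n} f fzero f≡0 = trans (cong (_+_ (f fzero)) rest≡0) (+-identityʳ (f fzero))
  where
  rest≡0 : sumFin (λ j → f (fsuc j)) ≡ + 0
  rest≡0 = trans (sumFin-cong (λ j → f≡0 (fsuc j) λ ())) (sumFin-zero n)
sumFin-single f (fsuc i) f≡0 = trans (cong₂ _+_ (f≡0 fzero λ ()) rest≡fi) (+-identityˡ (f (fsuc i)))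
  where
  rest≡fi : sumFin (λ j → f (fsuc j)) ≡ f (fsuc i)
  rest≡fi = sumFin-single (λ j → f (fsuc j)) i
              (λ j j≢i → f≡0 (fsuc j) (λ sj≡si → j≢i (suc-injective sj≡si)))

Matrix : ℕ → ℕ → Set
Matrix a b = Fin a → Fin b → ℤ

infixl 7 _·_
_·_ : Matrix a b → Matrix b c → Matrix a c
(A · B) i j = sumFin (λ k → A i k * B k j)

infix 4 _≋_ _≋_mod_

_≋_ : Matrix a b → Matrix a b → Set
A ≋ B = ∀ i j → A i j ≡ B i j

_≋_mod_ : Matrix a b → Matrix a b → ℤ → Set
A ≋ B mod m = ∀ i j → A i j ≡ B i j mod m

·-congˡ : (A : Matrix a b) {B B′ : Matrix b c} → B ≋ B′ → A · B ≋ A · B′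
·-congˡ A B≋B′ i j = sumFin-cong (λ k → cong (A i k *_) (B≋B′ k j))

·-congʳ : (B : Matrix b c) {A A′ : Matrix a b} → A ≋ A′ → A · B ≋ A′ · B
·-congʳ B A≋A′ i j = sumFin-cong (λ k → cong (_* B k j) (A≋A′ i k))

≋-mod-refl : (A : Matrix a b) → A ≋ A mod m
≋-mod-refl A i j = ≡⇒≡-mod refl

·-cong-mod : {A A′ : Matrix a b} {B B′ : Matrix b c} →
             A ≋ A′ mod m → B ≋ B′ mod m → A · B ≋ A′ · B′ mod m
·-cong-mod A≋A′ B≋B′ i j = sumFin-cong-mod (λ k → *-cong-mod (A≋A′ i k) (B≋B′ k j))

·-assoc : (A : Matrix a b) (B : Matrix b c) (C : Matrix c e) → (A · B) · C ≋ A · (B · C)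
·-assoc A B C i j = begin
  sumFin (λ l → sumFin (λ k → A i k * B k l) * C l j)
    ≡⟨ sumFin-cong (λ l → sym (sumFin-*ʳ (C l j) (λ k → A i k * B k l))) ⟩
  sumFin (λ l → sumFin (λ k → A i k * B k l * C l j))
    ≡⟨ sumFin-swap (λ l k → A i k * B k l * C l j) ⟩
  sumFin (λ k → sumFin (λ l → A i k * B k l * C l j))
    ≡⟨ sumFin-cong (λ k → sumFin-cong (λ l → *-assoc (A i k) (B k l) (C l j))) ⟩
  sumFin (λ k → sumFin (λ l → A i k * (B k l * C l j)))
    ≡⟨ sumFin-cong (λ k → sumFin-*ˡ (A i k) (λ l → B k l * C l j)) ⟩
  sumFin (λ k → A i k * sumFin (λ l → B k l * C l j))
    ∎
  where open ≡-Reasoning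

·-zeroˡ : {A : Matrix a b} (B : Matrix b c) → (∀ i k → A i k ≡ + 0) → ∀ i j → (A · B) i j ≡ + 0
·-zeroˡ {b = b} B A≡0 i j = trans (sumFin-cong (λ k → cong (_* B k j) (A≡0 i k))) (sumFin-zero b)

·-zeroʳ : (A : Matrix a b) {B : Matrix b c} → (∀ k j → B k j ≡ + 0) → ∀ i j → (A · B) i j ≡ + 0
·-zeroʳ {b = b} A B≡0 i j =
  trans (sumFin-cong (λ k → trans (cong (A i k *_) (B≡0 k j)) (*-zeroʳ (A i k)))) (sumFin-zero b)

identity-off : {i j : Fin n} → i ≢ j → identity i j ≡ + 0
identity-off {i = i} {j} i≢j with i ≟ j
... | yes i≡j = contradiction i≡j i≢j
... | no _    = refl

identity-diag : (i : Fin n) → identity i i ≡ + 1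
identity-diag i with i ≟ i
... | yes _   = refl
... | no i≢i = contradiction refl i≢i

identity-· : (A : Matrix n b) → identity · A ≋ A
identity-· A i j = trans
  (sumFin-single _ i (λ k k≢i →
    trans (cong (_* A k j) (identity-off (λ i≡k → k≢i (sym i≡k)))) (*-zeroˡ (A k j))))
  (trans (cong (_* A i j) (identity-diag i)) (*-identityˡ (A i j)))

·-identity : (A : Matrix a n) → A · identity ≋ A
·-identity A i j = trans
  (sumFin-single _ j (λ k k≢j → trans (cong (A i k *_) (identity-off k≢j)) (*-zeroʳ (A i k))))
  (trans (cong (A i j *_) (identity-diag j)) (*-identityʳ (A i j)))

·-cancelˡ : (P′ : Matrix a n) (P : Matrix n a) (X : Matrix a b) → P′ · P ≋ identity → P′ · (P · X) ≋ X
·-cancelˡ P′ P X P′P≋I i j = begin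
  (P′ · (P · X)) i j   ≡⟨ sym (·-assoc P′ P X i j) ⟩
  ((P′ · P) · X) i j   ≡⟨ ·-congʳ X P′P≋I i j ⟩
  (identity · X) i j   ≡⟨ identity-· X i j ⟩
  X i j                ∎
  where open ≡-Reasoning

·-cancelʳ : (X : Matrix a b) (Q : Matrix b n) (Q′ : Matrix n b) → Q · Q′ ≋ identity → (X · Q) · Q′ ≋ X
·-cancelʳ X Q Q′ QQ′≋I i j = begin
  ((X · Q) · Q′) i j   ≡⟨ ·-assoc X Q Q′ i j ⟩
  (X · (Q · Q′)) i j   ≡⟨ ·-congˡ X QQ′≋I i j ⟩
  (X · identity) i j   ≡⟨ ·-identity X i j ⟩
  X i j                ∎
  where open ≡-Reasoning

sandwich-cancel : {D S : Mat n} (P P′ Q Q′ : Mat n) →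
                  (P · D) · Q ≋ S → P′ · P ≋ identity → Q · Q′ ≋ identity → (P′ · S) · Q′ ≋ D
sandwich-cancel {D = D} {S} P P′ Q Q′ PDQ≋S P′P≋I QQ′≋I i j = begin
  ((P′ · S) · Q′) i j                 ≡⟨ ·-congʳ Q′ (·-congˡ P′ (λ k l → sym (PDQ≋S k l))) i j ⟩
  ((P′ · ((P · D) · Q)) · Q′) i j     ≡⟨ ·-assoc P′ _ Q′ i j ⟩
  (P′ · (((P · D) · Q) · Q′)) i j     ≡⟨ ·-congˡ P′ (·-cancelʳ (P · D) Q Q′ QQ′≋I) i j ⟩
  (P′ · (P · D)) i j                  ≡⟨ ·-cancelˡ P′ P D P′P≋I i j ⟩
  D i j                               ∎
  where open ≡-Reasoning

RankModAtMost : ℤ → (r : ℕ) → Matrix a b → Set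
RankModAtMost {a} {b} m r A = Σ (Matrix a r) λ U → Σ (Matrix r b) λ V → A ≋ U · V mod m

rankMod-resp-≋ : {A B : Matrix a b} → A ≋ B → RankModAtMost m r A → RankModAtMost m r B
rankMod-resp-≋ A≋B (U , V , A≋UV) = U , V , λ i j → ≡-mod-trans (≡⇒≡-mod (sym (A≋B i j))) (A≋UV i j)

rankMod-sandwich : {A : Matrix b c} (P : Matrix a b) (Q : Matrix c e) →
                         RankModAtMost m r A → RankModAtMost m r ((P · A) · Q)
rankMod-sandwich {m = m} {A = A} P Q (U , V , A≋UV) = P · U , V · Q , λ i j → begin
  ((P · A) · Q) i j         ≈⟨ ·-cong-mod (·-cong-mod (≋-mod-refl P) A≋UV) (≋-mod-refl Q) i j ⟩
  ((P · (U · V)) · Q) i j   ≡⟨ ·-congʳ Q (λ k l → sym (·-assoc P U V k l)) i j ⟩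
  (((P · U) · V) · Q) i j   ≡⟨ ·-assoc (P · U) V Q i j ⟩
  ((P · U) · (V · Q)) i j   ∎
  where open import Relation.Binary.Reasoning.Setoid (≡-mod-setoid m)

minor₂ : Matrix a b → Fin a → Fin a → Fin b → Fin b → ℤ
minor₂ A r r′ s s′ = A r s * A r′ s′ - A r s′ * A r′ s

principalMinor₃ : Mat n → Fin n → Fin n → Fin n → ℤ
principalMinor₃ A i j k = A i i * minor₂ A j k j k - A i j * minor₂ A j k i k + A i k * minor₂ A j k i j

minor₂-cong-mod : {A B : Matrix a b} → A ≋ B mod m →
                  ∀ r r′ s s′ → minor₂ A r r′ s s′ ≡ minor₂ B r r′ s s′ mod m
minor₂-cong-mod A≋B r r′ s s′ =
  +-cong-mod (*-cong-mod (A≋B r s) (A≋B r′ s′)) (-‿cong-mod (*-cong-mod (A≋B r s′) (A≋B r′ s)))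

principalMinor₃-cong-mod : {A B : Mat n} → A ≋ B mod m →
                           ∀ i j k → principalMinor₃ A i j k ≡ principalMinor₃ B i j k mod m
principalMinor₃-cong-mod A≋B i j k = +-cong-mod
  (+-cong-mod (*-cong-mod (A≋B i i) (minor₂-cong-mod A≋B j k j k))
              (-‿cong-mod (*-cong-mod (A≋B i j) (minor₂-cong-mod A≋B j k i k))))
  (*-cong-mod (A≋B i k) (minor₂-cong-mod A≋B j k i j))

rankMod≤1⇒minor₂≡0 : {A : Matrix a b} → RankModAtMost m 1 A →
                     ∀ r r′ s s′ → minor₂ A r r′ s s′ ≡ + 0 mod m
rankMod≤1⇒minor₂≡0 (U , V , A≋UV) r r′ s s′ = ≡-mod-trans (minor₂-cong-mod A≋UV r r′ s s′)
  (≡⇒≡-mod (rank-one (U r fzero) (U r′ fzero) (V fzero s) (V fzero s′)))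
  where
  -- (U · V) r s unfolds to U r 0 * V 0 s + + 0.
  rank-one : ∀ a b c d → (a * c + + 0) * (b * d + + 0) - (a * d + + 0) * (b * c + + 0) ≡ + 0
  rank-one = solve-∀

rankMod≤2⇒principalMinor₃≡0 : {A : Mat n} → RankModAtMost m 2 A →
                              ∀ i j k → principalMinor₃ A i j k ≡ + 0 mod m
rankMod≤2⇒principalMinor₃≡0 (U , V , A≋UV) i j k = ≡-mod-trans (principalMinor₃-cong-mod A≋UV i j k)
  (≡⇒≡-mod (rank-two (u i) (u j) (u k) (v i) (v j) (v k) (u′ i) (u′ j) (u′ k) (v′ i) (v′ j) (v′ k)))
  where
  u u′ v v′ : Fin _ → ℤ
  u  l = U l fzero
  u′ l = U l (fsuc fzero)
  v  l = V fzero l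
  v′ l = V (fsuc fzero) l
  rank-two : ∀ a0 a1 a2 b0 b1 b2 c0 c1 c2 d0 d1 d2 →
    let m₀₀ = a0 * b0 + (c0 * d0 + + 0) ; m₀₁ = a0 * b1 + (c0 * d1 + + 0) ; m₀₂ = a0 * b2 + (c0 * d2 + + 0)
        m₁₀ = a1 * b0 + (c1 * d0 + + 0) ; m₁₁ = a1 * b1 + (c1 * d1 + + 0) ; m₁₂ = a1 * b2 + (c1 * d2 + + 0)
        m₂₀ = a2 * b0 + (c2 * d0 + + 0) ; m₂₁ = a2 * b1 + (c2 * d1 + + 0) ; m₂₂ = a2 * b2 + (c2 * d2 + + 0)
    in m₀₀ * (m₁₁ * m₂₂ - m₁₂ * m₂₁) - m₀₁ * (m₁₀ * m₂₂ - m₁₂ * m₂₀) + m₀₂ * (m₁₀ * m₂₁ - m₁₁ * m₂₀) ≡ + 0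
  rank-two = solve-∀

principalMinor₃-diagonal : {A : Mat n} {i j k : Fin n} → (∀ r s → r ≢ s → A r s ≡ + 0) →
                  i ≢ j → i ≢ k → j ≢ k → principalMinor₃ A i j k ≡ A i i * (A j j * A k k)
principalMinor₃-diagonal {A = A} {i} {j} {k} off i≢j i≢k j≢k = expand {A i i} {A j j} {A k k}
  (off i j i≢j) (off i k i≢k) (off j i (λ j≡i → i≢j (sym j≡i)))
  (off j k j≢k) (off k i (λ k≡i → i≢k (sym k≡i))) (off k j (λ k≡j → j≢k (sym k≡j)))
  where
  expand : ∀ {x y z p q r s t u} → p ≡ + 0 → q ≡ + 0 → r ≡ + 0 → s ≡ + 0 → t ≡ + 0 → u ≡ + 0 →
           x * (y * z - s * u) - p * (r * z - s * t) + q * (r * u - y * t) ≡ x * (y * z)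
  expand {x} {y} {z} refl refl refl refl refl refl = diagonal x y z
    where
    diagonal : ∀ x y z →
      x * (y * z - + 0 * + 0) - + 0 * (+ 0 * z - + 0 * + 0) + + 0 * (+ 0 * + 0 - y * + 0) ≡ x * (y * z)
    diagonal = solve-∀

module _ {G : Graph n} {D : Mat n} (isD : IsDistanceMatrix G D) where

  distance-self : ∀ u → D u u ≡ + 0
  distance-self u with isD u u
  ... | _ , (_ , shortest) , Duu≡d = trans Duu≡d (cong +_ (n≤0⇒n≡0 (shortest 0 (nil u))))

  distance-adjacent : ∀ {u w} → Adj G u w → D u w ≡ + 1
  distance-adjacent {u} {w} uw with isD u w
  ... | ℕ.zero , (nil _ , _) , _ = contradiction uw (irrefl G)
  ... | 1 , _ , Duw≡1 = Duw≡1
  ... | ℕ.suc (ℕ.suc _) , (_ , shortest) , _ with shortest 1 (cons uw (nil w))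
  ...   | s≤s ()

  distanceMatrix-rankMod≤1⇒∣1 : ∀ {u w} → Adj G u w → RankModAtMost m 1 D → m ∣ + 1
  distanceMatrix-rankMod≤1⇒∣1 {u = u} {w} uw rank =
    ≡0-mod⇒∣ (subst (_≡ + 0 mod _) edge-minor (rankMod≤1⇒minor₂≡0 rank u w u w))
    where
    edge-minor : minor₂ D u w u w ≡ - + 1
    edge-minor = cong₂ _-_ (cong₂ _*_ (distance-self u) (distance-self w))
                           (cong₂ _*_ (distance-adjacent uw) (distance-adjacent (Graph.sym G uw)))

bit : Bool → ℤ
bit false = + 0
bit true  = + 1

bit-sum-of-distinct : ∀ {β γ} → β ≢ γ → bit β + bit γ ≡ + 1
bit-sum-of-distinct {false} {false} β≢γ = contradiction refl β≢γ
bit-sum-of-distinct {false} {true}  _   = refl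
bit-sum-of-distinct {true}  {false} _   = refl
bit-sum-of-distinct {true}  {true}  β≢γ = contradiction refl β≢γ

module _ {G : Graph n} (colour : Fin n → Bool) (proper : ∀ {u v} → Adj G u v → colour u ≢ colour v) where

  private
    χ : Fin n → ℤ
    χ v = bit (colour v)

  walk-length-parity : ∀ {u v k} → Walk G u v k → + k ≡ χ u + χ v mod + 2
  walk-length-parity (nil u) = ≡-mod (divides (- χ u) (double (χ u)))
    where
    double : ∀ y → + 0 - (y + y) ≡ - y * + 2
    double = solve-∀
  walk-length-parity {u} {v} (cons {w = w} {k = k} uw walk) = begin
    + 1 + + k                 ≡⟨ cong (_+ + k) (sym (bit-sum-of-distinct (proper uw))) ⟩
    (χ u + χ w) + + k         ≈⟨ +-cong-mod (≡⇒≡-mod {x = χ u + χ w} refl) (walk-length-parity walk) ⟩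
    (χ u + χ w) + (χ w + χ v) ≈⟨ ≡-mod (divides (χ w) (cancel (χ u) (χ w) (χ v))) ⟩
    χ u + χ v                 ∎
    where
    open import Relation.Binary.Reasoning.Setoid (≡-mod-setoid (+ 2))
    cancel : ∀ y z t → (y + z) + (z + t) - (y + t) ≡ z * + 2
    cancel = solve-∀

  bipartite⇒distanceMatrix-rankMod2≤2 : {D : Mat n} → IsDistanceMatrix G D → RankModAtMost (+ 2) 2 D
  bipartite⇒distanceMatrix-rankMod2≤2 {D} isD = U , V , D≋UV
    where
    U : Matrix n 2
    U v fzero    = χ v
    U v (fsuc _) = + 1
    V : Matrix 2 n
    V fzero    v = + 1
    V (fsuc _) v = χ v
    expand : ∀ y z → y + z ≡ y * + 1 + (+ 1 * z + + 0)
    expand = solve-∀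
    D≋UV : D ≋ U · V mod + 2
    D≋UV u v with isD u v
    ... | _ , (walk , _) , Duv≡d =
      ≡-mod-trans (≡⇒≡-mod Duv≡d)
        (≡-mod-trans (walk-length-parity walk) (≡⇒≡-mod (expand (χ u) (χ v))))

first-edge : {G : Graph n} {u v : Fin n} {k : ℕ} → u ≢ v → Walk G u v k → ∃ (Adj G u)
first-edge u≢v (nil u)     = contradiction refl u≢v
first-edge _   (cons uw _) = _ , uw

connected⇒edge⊎trivial : {G : Graph n} → Connected G → ∃₂ (Adj G) ⊎ (∀ (u v : Fin n) → u ≡ v)
connected⇒edge⊎trivial {ℕ.zero}            _         = inj₂ λ ()
connected⇒edge⊎trivial {ℕ.suc ℕ.zero}      _         = inj₂ λ { fzero fzero → refl }
connected⇒edge⊎trivial {ℕ.suc (ℕ.suc _)} connected =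
  inj₁ (fzero , first-edge (λ ()) (proj₂ (connected fzero (fsuc fzero))))

smith-diag-∣ : {S : Mat n} → IsSmithForm S → ∀ {i j} → toℕ i ℕ.≤ toℕ j → S i i ∣ S j j
smith-diag-∣ (_ , _ , chain) {i} {j} i≤j with m≤n⇒m<n∨m≡n i≤j
... | inj₁ i<j = chain i j i<j
... | inj₂ i≡j rewrite toℕ-injective i≡j = ℕ∣.∣-refl

smith-odd-index<2 : {S : Mat n} → IsSmithForm S → RankModAtMost (+ 2) 2 S →
                    ∀ k → ¬ (+ 2 ∣ S k k) → toℕ k ℕ.< 2
smith-odd-index<2 _ _ fzero               _ = s≤s z≤n
smith-odd-index<2 _ _ (fsuc fzero)        _ = s≤s (s≤s z≤n)
smith-odd-index<2 {n = 2} _ _ (fsuc (fsuc ())) _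
smith-odd-index<2 {n = ℕ.suc (ℕ.suc (ℕ.suc _))} {S} smith@(diagonal , _) rank k@(fsuc (fsuc _)) 2∤Skk =
  ⊥-elim ([ odd-before i₀ z≤n , [ odd-before i₁ (s≤s z≤n) , odd-before i₂ (s≤s (s≤s z≤n)) ]′ ]′
    (map₂ (prime-∣-* prime[2] (S i₁ i₁) (S i₂ i₂)) (prime-∣-* prime[2] (S i₀ i₀) _ 2∣product)))
  where
  i₀ i₁ i₂ : Fin _
  i₀ = fzero
  i₁ = fsuc fzero
  i₂ = fsuc (fsuc fzero)
  odd-before : ∀ i → toℕ i ℕ.≤ toℕ k → ¬ (+ 2 ∣ S i i)
  odd-before i i≤k 2∣Sii = 2∤Skk (ℕ∣.∣-trans 2∣Sii (smith-diag-∣ smith i≤k))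
  2∣product : + 2 ∣ S i₀ i₀ * (S i₁ i₁ * S i₂ i₂)
  2∣product = ≡0-mod⇒∣ (subst (_≡ + 0 mod + 2) (principalMinor₃-diagonal diagonal (λ ()) (λ ()) (λ ()))
                                (rankMod≤2⇒principalMinor₃≡0 rank i₀ i₁ i₂))

smith-rankMod≤1 : {S : Mat n} → IsSmithForm S → ∀ k → toℕ k ℕ.< 2 → RankModAtMost (S k k) 1 S
smith-rankMod≤1 {n} {S} smith@(diagonal , _) k k<2 = U , V , S≋UV
  where
  U : Matrix n 1
  U fzero    _ = + 1
  U (fsuc _) _ = + 0
  V : Matrix 1 n
  V _ fzero    = S fzero fzero
  V _ (fsuc _) = + 0
  S≋UV : S ≋ U · V mod S k k
  S≋UV fzero    fzero    = ≡⇒≡-mod (sym (trans (+-identityʳ _) (*-identityˡ _)))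
  S≋UV fzero    (fsuc j) = ≡⇒≡-mod (diagonal fzero (fsuc j) λ ())
  S≋UV (fsuc i) fzero    = ≡⇒≡-mod (diagonal (fsuc i) fzero λ ())
  S≋UV (fsuc i) (fsuc j) with i ≟ j
  ... | yes refl = ∣⇒≡0-mod (smith-diag-∣ smith (≤-trans (s≤s⁻¹ k<2) (s≤s z≤n)))
  ... | no i≢j   = ≡⇒≡-mod (diagonal (fsuc i) (fsuc j) (λ si≡sj → i≢j (suc-injective si≡sj)))

mainTheorem7 : ∀ (n : ℕ) (G : Graph n) → Connected G → Bipartite G →
    (D : Mat n) → IsDistanceMatrix G D →
    ∀ (f : ℤ) → IsInvariantFactor D f → + 1 < f → + 2 ∣ f
mainTheorem7 n G connected (colour , proper) D isD _
  (S , (smith , P , Q , (P⁻¹ , _ , P⁻¹P≋I) , (Q⁻¹ , QQ⁻¹≋I , _) , PDQ≋S) , k , refl , f≢0) 1<f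
  with 2 ℕ∣.∣? ∣ S k k ∣ | connected⇒edge⊎trivial connected
... | yes 2∣f | _ = 2∣f
... | no 2∤f | inj₁ (_ , _ , uw) =
  contradiction (distanceMatrix-rankMod≤1⇒∣1 isD uw D-rank≤1) (>1⇒∤1 1<f)
  where
  S-rank≤2 : RankModAtMost (+ 2) 2 S
  S-rank≤2 = rankMod-resp-≋ PDQ≋S (rankMod-sandwich P Q (bipartite⇒distanceMatrix-rankMod2≤2 colour proper isD))
  k<2 : toℕ k ℕ.< 2
  k<2 = smith-odd-index<2 smith S-rank≤2 k 2∤f
  D-rank≤1 : RankModAtMost (S k k) 1 D
  D-rank≤1 = rankMod-resp-≋ (sandwich-cancel P P⁻¹ Q Q⁻¹ PDQ≋S P⁻¹P≋I QQ⁻¹≋I)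
               (rankMod-sandwich P⁻¹ Q⁻¹ (smith-rankMod≤1 smith k k<2))
... | no _ | inj₂ trivial = contradiction (trans (sym (PDQ≋S k k)) (·-zeroˡ Q (·-zeroʳ P D≡0) k k)) f≢0
  where
  D≡0 : ∀ u v → D u v ≡ + 0
  D≡0 u v = subst (λ v → D u v ≡ + 0) (trivial u v) (distance-self isD u)
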